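{- Let $G$ be a connected finite simple graph on at least three vertices. If the $1$-shunt intersection graph $A_1(G)$ is regular, then $G$ is a star $K_{1,n}$ or the minimum degree of $G$ satisfies $\delta(G)>1$.
   Context: A $1$-arc of $G$ is an ordered pair $(u,v)$ with $uv\in E(G)$, written $uv$. A $1$-arc $uv$ can be shunted onto the $1$-arc $vw$ if $w\neq u$ and $vw\in E(G)$. The graph $A_1(G)$ has as vertices the $1$-arcs of $G$ that can be shunted onto some other $1$-arc; two distinct vertices are adjacent iff the corresponding $1$-arcs share at least one vertex of $G$. -}

module Defs where

open import Data.Nat using (ℕ; zero; suc; _≤_; _<_)
open import Data.Fin using (Fin)
open import Data.Fin.Properties using (_≟_)
open import Data.Bool using (Bool; true; false; _∧_; _∨_; not; T)
open import Data.Product using (Σ; ∃; _×_; _,_)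
open import Data.List using (List; length; filter; allFin)
open import Relation.Nullary using (¬_; Dec; does)
open import Relation.Binary.PropositionalEquality using (_≡_; _≢_)

record SimpleGraph (n : ℕ) : Set where
  field
    adj   : Fin n → Fin n → Bool
    sym   : ∀ u v → adj u v ≡ adj v u
    irrefl : ∀ u → adj u u ≡ false
open SimpleGraph public

module _ {n : ℕ} (G : SimpleGraph n) where

  Adj : Fin n → Fin n → Set
  Adj u v = T (adj G u v)

  degree : Fin n → ℕ
  degree v = length (filter (λ w → T? (adj G v w)) (allFin n))
    where
    open import Data.Bool.Properties using (T?)

  minDegree>1 : Set
  minDegree>1 = ∀ v → 1 < degree v

  data Walk : Fin n → Fin n → Set where
    here : ∀ {u} → Walk u u
    step : ∀ {u v w} → Adj u v → Walk v w → Walk u w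

  Connected : Set
  Connected = ∀ u v → Walk u v

  IsStar : Set
  IsStar = Σ (Fin n) λ c → (∀ v → v ≢ c → Adj c v)
                         × (∀ u v → Adj u v → u ≡ c ⊎' v ≡ c)
    where
    open import Data.Sum using () renaming (_⊎_ to _⊎'_)

  Arc : Set
  Arc = Σ (Fin n) λ u → Σ (Fin n) λ v → Adj u v

  shuntable? : Fin n → Fin n → Bool
  shuntable? u v = anyB (λ w → not (does (w ≟ u)) ∧ adj G v w) (allFin n)
    where
    open import Data.List using (foldr; map)
    anyB : (Fin n → Bool) → List (Fin n) → Bool
    anyB p xs = foldr _∨_ false (map p xs)

  isA1Vertex : Fin n → Fin n → Bool
  isA1Vertex u v = adj G u v ∧ shuntable? u v

  A1Vertex : Set
  A1Vertex = Σ (Fin n) λ u → Σ (Fin n) λ v → T (isA1Vertex u v)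

  eqB : Fin n → Fin n → Bool
  eqB a b = does (a ≟ b)

  A1adj : Fin n → Fin n → Fin n → Fin n → Bool
  A1adj u v x y = not (eqB u x ∧ eqB v y)
                ∧ (eqB u x ∨ eqB u y ∨ eqB v x ∨ eqB v y)

  pairs : List (Fin n × Fin n)
  pairs = concatMapL (λ u → Data.List.map (λ v → (u , v)) (allFin n)) (allFin n)
    where
    import Data.List
    concatMapL = Data.List.concatMap

  A1degree : Fin n → Fin n → ℕ
  A1degree u v = length (filter (λ p → T? (isA1Vertex (fst p) (snd p) ∧ A1adj u v (fst p) (snd p))) pairs)
    where
    open import Data.Bool.Properties using (T?)
    open import Data.Product using () renaming (proj₁ to fst; proj₂ to snd)

  A1Regular : Set
  A1Regular = Σ ℕ λ r → ∀ u v → T (isA1Vertex u v) → A1degree u v ≡ r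

module Submission where

-- Suppose some vertex ℓ has degree at most 1. By connectivity it has exactly one
-- neighbour c. If some path c – x – y has y ≠ c, compare the A₁(G)-neighbourhoods of
-- the arcs ℓc and cx: every A₁-neighbour of ℓc contains c (no arc through the leaf ℓ
-- other than ℓc itself can be shunted), so it is cx or an A₁-neighbour of cx; in
-- addition ℓc and yx are A₁-neighbours of cx but not of ℓc. Hence ℓc has strictly
-- smaller A₁-degree than cx, contradicting regularity. Otherwise every vertex is
-- within distance one of c and every edge contains c, so G is a star.

open import Defs hiding (sym)
open import Data.Bool using (T)
open import Data.Bool.Properties using (T?; T-∧)
open import Data.Empty using (⊥-elim)
open import Data.Fin using (Fin; zero; punchIn)
open import Data.Fin.Properties using (_≟_; all?; any?; ¬∀⟶∃¬; punchInᵢ≢i)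
open import Data.List using (List; []; _∷_; _++_; length; filter; map; concatMap; cartesianProduct; allFin)
open import Data.List.Membership.Propositional using (_∈_; find; lose)
open import Data.List.Membership.Propositional.Properties using (∈-allFin; ∈-cartesianProduct⁺)
open import Data.List.Properties using (filter-none; filter-≐)
open import Data.List.Relation.Unary.All as All using ()
open import Data.List.Relation.Unary.AllPairs using (_∷_)
open import Data.List.Relation.Unary.Any using (here; there)
open import Data.List.Relation.Unary.Any.Properties using (any⁺; any⁻)
open import Data.List.Relation.Unary.Unique.Propositional using (Unique)
open import Data.List.Relation.Unary.Unique.Propositional.Properties using (cartesianProduct⁺; allFin⁺)
open import Data.Nat using (ℕ; suc; _≤_; _<_; _+_; z≤n; s≤s; s≤s⁻¹)
open import Data.Nat.Properties using (+-suc; ≤-trans; ≤-reflexive; m≤n⇒m≤1+n; ≤⇒≯; ≮⇒≥; <-irrefl; _<?_; module ≤-Reasoning)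
open import Data.Product using (∃; _×_; _,_; proj₂)
open import Data.Product.Properties using (≡-dec; ,-injectiveˡ)
open import Data.Sum using (_⊎_; inj₁; inj₂; [_,_]′)
open import Data.Unit using (tt)
open import Function using (_∘_; id)
open import Function.Bundles using (_⇔_; mk⇔; Equivalence)
open import Level using (Level)
open import Relation.Binary.Definitions using (DecidableEquality)
open import Relation.Binary.PropositionalEquality using (_≡_; _≢_; refl; sym; trans; subst; cong; cong₂)
open import Relation.Nullary using (¬_; Dec; yes; no; ¬?; _×-dec_; _⊎-dec_; contradiction)
open import Relation.Nullary.Decidable using (decidable-stable)
open import Relation.Unary using (Pred; Decidable; _⊆_)
open import Relation.Unary.Properties using (_∪?_)

T-does⇔ : ∀ {a} {A : Set a} (a? : Dec A) → T (Dec.does a?) ⇔ A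
T-does⇔ (yes a) = mk⇔ (λ _ → a) (λ _ → tt)
T-does⇔ (no ¬a) = mk⇔ (λ ()) ¬a

count : ∀ {a r} {A : Set a} {R : Pred A r} → Decidable R → List A → ℕ
count R? xs = length (filter R? xs)

module _ {a p q : Level} {A : Set a} {P : Pred A p} {Q : Pred A q} where

  count-mono : (P? : Decidable P) (Q? : Decidable Q) → P ⊆ Q → ∀ xs → count P? xs ≤ count Q? xs
  count-mono P? Q? P⊆Q []       = z≤n
  count-mono P? Q? P⊆Q (x ∷ xs) with P? x | Q? x
  ... | yes _  | yes _  = s≤s (count-mono P? Q? P⊆Q xs)
  ... | yes px | no ¬qx = contradiction (P⊆Q px) ¬qx
  ... | no _   | yes _  = m≤n⇒m≤1+n (count-mono P? Q? P⊆Q xs)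
  ... | no _   | no _   = count-mono P? Q? P⊆Q xs

  count-∪ : (P? : Decidable P) (Q? : Decidable Q) → ∀ xs → count (P? ∪? Q?) xs ≤ count P? xs + count Q? xs
  count-∪ P? Q? []       = z≤n
  count-∪ P? Q? (x ∷ xs) with P? x | Q? x
  ... | yes _ | yes _ = s≤s (≤-trans (m≤n⇒m≤1+n (count-∪ P? Q? xs)) (≤-reflexive (sym (+-suc _ _))))
  ... | yes _ | no _  = s≤s (count-∪ P? Q? xs)
  ... | no _  | yes _ = ≤-trans (s≤s (count-∪ P? Q? xs)) (≤-reflexive (sym (+-suc _ _)))
  ... | no _  | no _  = count-∪ P? Q? xs

  count-∪-disjoint : (P? : Decidable P) (Q? : Decidable Q) → (∀ {x} → P x → ¬ Q x) →
                     ∀ xs → count (P? ∪? Q?) xs ≡ count P? xs + count Q? xs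
  count-∪-disjoint P? Q? P∩Q=∅ []       = refl
  count-∪-disjoint P? Q? P∩Q=∅ (x ∷ xs) with P? x | Q? x
  ... | yes px | yes qx = ⊥-elim (P∩Q=∅ px qx)
  ... | yes _  | no _   = cong suc (count-∪-disjoint P? Q? P∩Q=∅ xs)
  ... | no _   | yes _  = trans (cong suc (count-∪-disjoint P? Q? P∩Q=∅ xs)) (sym (+-suc _ _))
  ... | no _   | no _   = count-∪-disjoint P? Q? P∩Q=∅ xs

count-≟-unique : ∀ {a} {A : Set a} (_≟_ : DecidableEquality A) {x : A} {xs : List A} →
                 Unique xs → x ∈ xs → count (_≟ x) xs ≡ 1
count-≟-unique _≟_ {x} (x∉xs ∷ _) (here refl) with x ≟ x
... | yes _  = cong suc (cong length (filter-none (_≟ x) (All.map (λ x≢y y≡x → x≢y (sym y≡x)) x∉xs)))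
... | no x≢x = contradiction refl x≢x
count-≟-unique _≟_ {x} {y ∷ _} (y∉xs ∷ xs!) (there x∈xs) with y ≟ x
... | yes y≡x = contradiction y≡x (All.lookup y∉xs x∈xs)
... | no _    = count-≟-unique _≟_ xs! x∈xs

module _ {n : ℕ} (G : SimpleGraph n) where

  Adj-sym : ∀ {u v} → Adj G u v → Adj G v u
  Adj-sym {u} {v} = subst T (SimpleGraph.sym G u v)

  Adj⇒≢ : ∀ {u v} → Adj G u v → u ≢ v
  Adj⇒≢ {u} uu refl = subst T (irrefl G u) uu

  Walk⇒first-step : ∀ {u v} → Walk G u v → u ≢ v → ∃ (Adj G u)
  Walk⇒first-step here        u≢u = ⊥-elim (u≢u refl)
  Walk⇒first-step (step uw _) _   = _ , uw

  IsStar-centre : ∀ c → Connected G → (∀ {x y} → Adj G c x → Adj G x y → y ≡ c) → IsStar G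
  IsStar-centre c connected no-path = c , c-adj , edge-meets-c
    where
    reach : ∀ {u v} → Walk G u v → u ≡ c ⊎ Adj G c u → v ≡ c ⊎ Adj G c v
    reach here         near        = near
    reach (step uw wv) (inj₁ refl) = reach wv (inj₂ uw)
    reach (step uw wv) (inj₂ cu)   = reach wv (inj₁ (no-path cu uw))

    c-adj : ∀ v → v ≢ c → Adj G c v
    c-adj v v≢c = [ ⊥-elim ∘ v≢c , id ]′ (reach (connected c v) (inj₁ refl))

    edge-meets-c : ∀ u v → Adj G u v → u ≡ c ⊎ v ≡ c
    edge-meets-c u v uv with u ≟ c
    ... | yes u≡c = inj₁ u≡c
    ... | no u≢c  = inj₂ (no-path (c-adj u u≢c) uv)

  count-≟-allFin : ∀ a → count (_≟ a) (allFin n) ≡ 1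
  count-≟-allFin a = count-≟-unique _≟_ (allFin⁺ n) (∈-allFin a)

  two-neighbours⇒2≤degree : ∀ {v a b} → a ≢ b → Adj G v a → Adj G v b → 2 ≤ degree G v
  two-neighbours⇒2≤degree {v} {a} {b} a≢b va vb = begin
    2                                                  ≡⟨ cong₂ _+_ (count-≟-allFin a) (count-≟-allFin b) ⟨
    count (_≟ a) (allFin n) + count (_≟ b) (allFin n)  ≡⟨ count-∪-disjoint (_≟ a) (_≟ b) a≠b (allFin n) ⟨
    count ((_≟ a) ∪? (_≟ b)) (allFin n)                ≤⟨ count-mono _ (λ w → T? (adj G v w)) a∪b⊆N[v] (allFin n) ⟩
    degree G v                                         ∎
    where
    open ≤-Reasoning
    a≠b : ∀ {w} → w ≡ a → w ≢ b
    a≠b refl refl = a≢b refl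
    a∪b⊆N[v] : ∀ {w} → w ≡ a ⊎ w ≡ b → Adj G v w
    a∪b⊆N[v] (inj₁ refl) = va
    a∪b⊆N[v] (inj₂ refl) = vb

  degree≤1⇒neighbour-unique : ∀ {v a b} → degree G v ≤ 1 → Adj G v a → Adj G v b → a ≡ b
  degree≤1⇒neighbour-unique {a = a} {b} deg≤1 va vb =
    decidable-stable (a ≟ b) λ a≢b → ≤⇒≯ deg≤1 (two-neighbours⇒2≤degree a≢b va vb)

  shuntable⁻ : ∀ {u v} → T (shuntable? G u v) → ∃ λ w → w ≢ u × Adj G v w
  shuntable⁻ {u} {v} t with find (any⁻ _ (allFin n) t)
  ... | w , _ , pw = w , Equivalence.to (T-does⇔ (¬? (w ≟ u) ×-dec T? (adj G v w))) pw

  shuntable⁺ : ∀ {u v w} → w ≢ u → Adj G v w → T (shuntable? G u v)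
  shuntable⁺ {u} {v} {w} w≢u vw =
    any⁺ _ (lose (∈-allFin w) (Equivalence.from (T-does⇔ (¬? (w ≟ u) ×-dec T? (adj G v w))) (w≢u , vw)))

  isA1Vertex⁺ : ∀ {u v w} → w ≢ u → Adj G u v → Adj G v w → T (isA1Vertex G u v)
  isA1Vertex⁺ w≢u uv vw = Equivalence.from T-∧ (uv , shuntable⁺ w≢u vw)

  Meets : Fin n × Fin n → Fin n × Fin n → Set
  Meets (u , v) (a , b) = u ≡ a ⊎ u ≡ b ⊎ v ≡ a ⊎ v ≡ b

  -- Shaped like the Boolean test in A1degree, so that isA1Neighbour? computes exactly its bits.
  IsA1Neighbour : Fin n × Fin n → Fin n × Fin n → Set
  IsA1Neighbour (u , v) (a , b) =
    (Adj G a b × T (shuntable? G a b)) × ¬ (u ≡ a × v ≡ b) × Meets (u , v) (a , b)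

  isA1Neighbour? : ∀ p → Decidable (IsA1Neighbour p)
  isA1Neighbour? (u , v) (a , b) =
    (T? (adj G a b) ×-dec T? (shuntable? G a b))
    ×-dec ¬? (u ≟ a ×-dec v ≟ b)
    ×-dec (u ≟ a ⊎-dec u ≟ b ⊎-dec v ≟ a ⊎-dec v ≟ b)

  IsA1Neighbour-irrefl : ∀ p → ¬ IsA1Neighbour p p
  IsA1Neighbour-irrefl p (_ , p≢p , _) = p≢p (refl , refl)

  A1degree≡count : ∀ u v → A1degree G u v ≡ count (isA1Neighbour? (u , v)) (pairs G)
  A1degree≡count u v = cong length (filter-≐ _ _ (to , from) (pairs G))
    where
    to : ∀ {q} → T (Dec.does (isA1Neighbour? (u , v) q)) → IsA1Neighbour (u , v) q
    to = Equivalence.to (T-does⇔ (isA1Neighbour? (u , v) _))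
    from : ∀ {q} → IsA1Neighbour (u , v) q → T (Dec.does (isA1Neighbour? (u , v) q))
    from = Equivalence.from (T-does⇔ (isA1Neighbour? (u , v) _))

  _≟ₚ_ : DecidableEquality (Fin n × Fin n)
  _≟ₚ_ = ≡-dec _≟_ _≟_

  pairs≡cartesianProduct : pairs G ≡ cartesianProduct (allFin n) (allFin n)
  pairs≡cartesianProduct = concatMap-pairing (allFin n) (allFin n)
    where
    concatMap-pairing : ∀ (xs ys : List (Fin n)) →
                        concatMap (λ x → map (x ,_) ys) xs ≡ cartesianProduct xs ys
    concatMap-pairing []       ys = refl
    concatMap-pairing (x ∷ xs) ys = cong (map (x ,_) ys ++_) (concatMap-pairing xs ys)

  count-≟-pairs : ∀ p → count (_≟ₚ p) (pairs G) ≡ 1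
  count-≟-pairs (a , b) rewrite pairs≡cartesianProduct =
    count-≟-unique _≟ₚ_ (cartesianProduct⁺ (allFin⁺ n) (allFin⁺ n))
                        (∈-cartesianProduct⁺ (∈-allFin a) (∈-allFin b))

  module _ {ℓ c x y : Fin n} (ℓ-leaf : ∀ {w} → Adj G ℓ w → w ≡ c)
           (ℓc : Adj G ℓ c) (cx : Adj G c x) (xy : Adj G x y) (y≢c : y ≢ c) where

    private
      x≢c : x ≢ c
      x≢c x≡c = Adj⇒≢ cx (sym x≡c)
      c≢ℓ : c ≢ ℓ
      c≢ℓ c≡ℓ = Adj⇒≢ ℓc (sym c≡ℓ)
      x≢ℓ : x ≢ ℓ
      x≢ℓ refl = y≢c (ℓ-leaf xy)
      y≢ℓ : y ≢ ℓ
      y≢ℓ refl = x≢c (ℓ-leaf (Adj-sym xy))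

      yx∉Nℓc : ¬ IsA1Neighbour (ℓ , c) (y , x)
      yx∉Nℓc (_ , _ , inj₁ ℓ≡y)                = y≢ℓ (sym ℓ≡y)
      yx∉Nℓc (_ , _ , inj₂ (inj₁ ℓ≡x))         = x≢ℓ (sym ℓ≡x)
      yx∉Nℓc (_ , _ , inj₂ (inj₂ (inj₁ c≡y))) = y≢c (sym c≡y)
      yx∉Nℓc (_ , _ , inj₂ (inj₂ (inj₂ c≡x))) = x≢c (sym c≡x)

      Nℓc⊆cx∪Ncx : ∀ {p} → IsA1Neighbour (ℓ , c) p → p ≡ (c , x) ⊎ IsA1Neighbour (c , x) p
      Nℓc⊆cx∪Ncx ((ℓb , _) , ≢ℓc , inj₁ refl) = ⊥-elim (≢ℓc (refl , sym (ℓ-leaf ℓb)))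
      -- an arc aℓ into the leaf forces a = c, and it could only be shunted back onto ℓc
      Nℓc⊆cx∪Ncx ((aℓ , sh) , _ , inj₂ (inj₁ refl)) with shuntable⁻ sh
      ... | w , w≢a , ℓw = ⊥-elim (w≢a (trans (ℓ-leaf ℓw) (sym (ℓ-leaf (Adj-sym aℓ)))))
      Nℓc⊆cx∪Ncx {a , b} (arc , _ , inj₂ (inj₂ c∈ab)) with (a , b) ≟ₚ (c , x)
      ... | yes ab≡cx = inj₁ ab≡cx
      ... | no ab≢cx  = inj₂ (arc , (λ { (refl , refl) → ab≢cx refl }) , [ inj₁ , inj₂ ∘ inj₁ ]′ c∈ab)

      ℓc∈Ncx : IsA1Neighbour (c , x) (ℓ , c)
      ℓc∈Ncx = (ℓc , shuntable⁺ x≢ℓ cx) , (λ { (c≡ℓ , _) → c≢ℓ c≡ℓ }) , inj₂ (inj₁ refl)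

      yx∈Ncx : IsA1Neighbour (c , x) (y , x)
      yx∈Ncx = (Adj-sym xy , shuntable⁺ (λ c≡y → y≢c (sym c≡y)) (Adj-sym cx))
             , (λ { (c≡y , _) → y≢c (sym c≡y) }) , inj₂ (inj₂ (inj₂ refl))

    A1degree-leaf-arc< : A1degree G ℓ c < A1degree G c x
    A1degree-leaf-arc< = s≤s⁻¹ (begin
      suc (suc (A1degree G ℓ c))                ≡⟨ cong (suc ∘ suc) (A1degree≡count ℓ c) ⟩
      suc (suc (count Nℓc P))                   ≡⟨ cong₂ (λ i j → i + (j + count Nℓc P)) (count-≟-pairs (y , x)) (count-≟-pairs (ℓ , c)) ⟨
      count yx? P + (count ℓc? P + count Nℓc P) ≡⟨ cong (count yx? P +_) (count-∪-disjoint ℓc? Nℓc ℓc∉Nℓc P) ⟨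
      count yx? P + count (ℓc? ∪? Nℓc) P        ≡⟨ count-∪-disjoint yx? (ℓc? ∪? Nℓc) yx∉ℓc∪Nℓc P ⟨
      count (yx? ∪? (ℓc? ∪? Nℓc)) P             ≤⟨ count-mono _ (cx? ∪? Ncx) yx∪ℓc∪Nℓc⊆cx∪Ncx P ⟩
      count (cx? ∪? Ncx) P                      ≤⟨ count-∪ cx? Ncx P ⟩
      count cx? P + count Ncx P                 ≡⟨ cong₂ _+_ (count-≟-pairs (c , x)) (sym (A1degree≡count c x)) ⟩
      suc (A1degree G c x)                      ∎)
      where
      open ≤-Reasoning
      P : List (Fin n × Fin n)
      P = pairs G
      Nℓc : Decidable (IsA1Neighbour (ℓ , c))
      Nℓc = isA1Neighbour? (ℓ , c)
      Ncx : Decidable (IsA1Neighbour (c , x))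
      Ncx = isA1Neighbour? (c , x)
      yx? : Decidable (_≡ (y , x))
      yx? = _≟ₚ (y , x)
      ℓc? : Decidable (_≡ (ℓ , c))
      ℓc? = _≟ₚ (ℓ , c)
      cx? : Decidable (_≡ (c , x))
      cx? = _≟ₚ (c , x)
      ℓc∉Nℓc : ∀ {p} → p ≡ (ℓ , c) → ¬ IsA1Neighbour (ℓ , c) p
      ℓc∉Nℓc refl = IsA1Neighbour-irrefl (ℓ , c)
      yx∉ℓc∪Nℓc : ∀ {p} → p ≡ (y , x) → ¬ (p ≡ (ℓ , c) ⊎ IsA1Neighbour (ℓ , c) p)
      yx∉ℓc∪Nℓc refl (inj₁ yx≡ℓc)  = y≢ℓ (,-injectiveˡ yx≡ℓc)
      yx∉ℓc∪Nℓc refl (inj₂ yx∈Nℓc) = yx∉Nℓc yx∈Nℓc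
      yx∪ℓc∪Nℓc⊆cx∪Ncx : ∀ {p} → p ≡ (y , x) ⊎ p ≡ (ℓ , c) ⊎ IsA1Neighbour (ℓ , c) p →
                         p ≡ (c , x) ⊎ IsA1Neighbour (c , x) p
      yx∪ℓc∪Nℓc⊆cx∪Ncx (inj₁ refl)          = inj₂ yx∈Ncx
      yx∪ℓc∪Nℓc⊆cx∪Ncx (inj₂ (inj₁ refl))   = inj₂ ℓc∈Ncx
      yx∪ℓc∪Nℓc⊆cx∪Ncx (inj₂ (inj₂ p∈Nℓc)) = Nℓc⊆cx∪Ncx p∈Nℓc

module _ {m : ℕ} (G : SimpleGraph (suc (suc m))) (connected : Connected G) (regular : A1Regular G) where

  A1Regular⇒leaf⇒IsStar : ∀ ℓ → degree G ℓ ≤ 1 → IsStar G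
  A1Regular⇒leaf⇒IsStar ℓ deg≤1 with Walk⇒first-step G (connected ℓ (punchIn ℓ zero)) (punchInᵢ≢i ℓ zero ∘ sym)
  ... | c , ℓc with any? (λ x → any? (λ y → T? (adj G c x) ×-dec T? (adj G x y) ×-dec ¬? (y ≟ c)))
  ... | no no-path = IsStar-centre G c connected λ {x} {y} cx xy →
                       decidable-stable (y ≟ c) λ y≢c → no-path (x , y , cx , xy , y≢c)
  ... | yes (x , y , cx , xy , y≢c) =
          ⊥-elim (<-irrefl (trans (proj₂ regular ℓ c A1ℓc) (sym (proj₂ regular c x A1cx)))
                           (A1degree-leaf-arc< G ℓ-leaf ℓc cx xy y≢c))
    where
    ℓ-leaf : ∀ {w} → Adj G ℓ w → w ≡ c
    ℓ-leaf ℓw = degree≤1⇒neighbour-unique G deg≤1 ℓw ℓc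
    A1ℓc : T (isA1Vertex G ℓ c)
    A1ℓc = isA1Vertex⁺ G (λ x≡ℓ → y≢c (ℓ-leaf (subst (λ v → Adj G v y) x≡ℓ xy))) ℓc cx
    A1cx : T (isA1Vertex G c x)
    A1cx = isA1Vertex⁺ G y≢c cx xy

mainTheorem8 : ∀ (n : ℕ) → 3 ≤ n → (G : SimpleGraph n) → Connected G →
                 A1Regular G → IsStar G ⊎ minDegree>1 G
mainTheorem8 (suc (suc (suc _))) (s≤s (s≤s (s≤s _))) G connected regular
  with all? (λ v → 1 <? degree G v)
... | yes deg>1 = inj₂ deg>1
... | no ¬deg>1 with ¬∀⟶∃¬ _ _ (λ v → 1 <? degree G v) ¬deg>1
... | ℓ , deg≯1 = inj₁ (A1Regular⇒leaf⇒IsStar G connected regular ℓ (≮⇒≥ deg≯1))
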